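{- Let $0<m<n$ and consider the uniform probability distribution over the $m$-card states on $n$ cards. Play one round of War from the random state, with random putback. Then Alice wins the round with probability $1/2$. Conditioned on Alice winning, the resulting state is uniformly distributed over all $(m+1)$-card states. Conditioned on Bob winning, the resulting state is uniformly distributed over all $(m-1)$-card states.
   Context: War with $n$ cards labelled $1,\dots,n$: a state is written $a_1\cdots a_i\,|\,a_{i+1}\cdots a_n$, where $a_1\cdots a_i$ is Alice's hand from top to bottom and $a_{i+1}\cdots a_n$ is Bob's hand from top to bottom; an $m$-card state is one where Alice holds $m$ cards (there are $n!$ of them). In a round both players reveal their top card and the owner of the higher card places both cards at the bottom of their own hand; under random putback the order of these two cards is chosen uniformly at random. -}

module Defs where

open import Data.Bool using (Bool; true; false; if_then_else_; _∧_; not)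
open import Data.Nat using (ℕ; zero; suc; _<ᵇ_; _∸_)
open import Data.Nat.Properties using () renaming (_≟_ to _≟ℕ_)
open import Data.List using (List; []; _∷_; _++_; map; concatMap; length; filterᵇ; upTo; take; drop)
open import Data.List.Properties using (≡-dec)
open import Data.Product using (_×_; _,_; proj₁; proj₂)
open import Data.Product.Properties using () renaming (≡-dec to ×-≡-dec)
open import Data.Integer using (+_)
open import Data.Rational using (ℚ; _/_; 0ℚ)
open import Relation.Nullary.Decidable using (isYes)

-- All permutations of a list (each arrangement listed once when the
-- entries are distinct): insert the head at every position.
insertEverywhere : ℕ → List ℕ → List (List ℕ)
insertEverywhere x []       = (x ∷ []) ∷ []
insertEverywhere x (y ∷ ys) = (x ∷ y ∷ ys) ∷ map (y ∷_) (insertEverywhere x ys)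

perms : List ℕ → List (List ℕ)
perms []       = [] ∷ []
perms (x ∷ xs) = concatMap (insertEverywhere x) (perms xs)

cards : ℕ → List ℕ
cards n = map suc (upTo n)

-- A state: (Alice's hand top-to-bottom , Bob's hand top-to-bottom).
State : Set
State = List ℕ × List ℕ

states : ℕ → ℕ → List State
states n m = map (λ l → take m l , drop m l) (perms (cards n))

_≟S_ : State → State → Bool
s ≟S t = isYes (×-≡-dec (≡-dec _≟ℕ_) (≡-dec _≟ℕ_) s t)

putback : Bool → ℕ → ℕ → List ℕ
putback true  x y = x ∷ y ∷ []
putback false x y = y ∷ x ∷ []

aliceWins : State → Bool
aliceWins (a ∷ _ , b ∷ _) = b <ᵇ a
aliceWins _               = false

bobWins : State → Bool
bobWins (a ∷ _ , b ∷ _) = a <ᵇ b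
bobWins _               = false

-- One round of War with putback coin c: the winner places both revealed
-- cards at the bottom of their hand, in the order given by c.
-- (Rounds from states with an empty hand are never used.)
playRound : State → Bool → State
playRound (a ∷ as , b ∷ bs) c =
  if b <ᵇ a then (as ++ putback c a b , bs) else (as , bs ++ putback c a b)
playRound s c = s

-- Equally likely outcomes of the experiment: a uniformly random m-card
-- state together with a fair putback coin.
Outcome : Set
Outcome = State × Bool

outcomes : ℕ → ℕ → List Outcome
outcomes n m = concatMap (λ s → (s , true) ∷ (s , false) ∷ []) (states n m)

startState : Outcome → State
startState = proj₁

result : Outcome → State
result (s , c) = playRound s c

-- a / d as a rational (0 if d = 0).
frac : ℕ → ℕ → ℚ
frac a zero    = 0ℚ
frac a (suc d) = (+ a) / suc d

count : {A : Set} → (A → Bool) → List A → ℕ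
count p xs = length (filterᵇ p xs)

Pr : {A : Set} → List A → (A → Bool) → ℚ
Pr xs E = frac (count E xs) (length xs)

PrCond : {A : Set} → List A → (A → Bool) → (A → Bool) → ℚ
PrCond xs E F = frac (count (λ x → E x ∧ F x) xs) (count F xs)

uniform : List State → State → ℚ
uniform L s = frac (count (_≟S s) L) (length L)

{-# OPTIONS --safe #-}
module Submission where

-- When Alice wins a round from (a ∷ as | b ∷ bs) with coin c, the result is
-- (as ++ putback c a b | bs), and the outcome can be read back off it: the last two
-- cards of Alice's new hand are {a, b}, the higher one is a, and their order gives c.
-- Conversely every (m+1)-card state arises this way, because the last two cards of
-- Alice's hand are distinct.  So the results of the Alice-winning outcomes list each
-- (m+1)-card state exactly once, and likewise the results of the Bob-winning outcomes
-- list each (m-1)-card state exactly once.  Since there are n! states of every size,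
-- Alice wins in n! of the 2·n! outcomes, and both conditional distributions are uniform.

open import Defs
open import Data.Bool using (Bool; true; false; T; _∧_)
open import Data.Bool.Properties using (T?; ∧-zeroʳ; ∧-identityʳ)
open import Data.Empty using (⊥-elim)
open import Data.Integer using (+_)
open import Data.List using (List; []; _∷_; _++_; map; concatMap; length; filterᵇ; take; drop; upTo; cartesianProduct)
open import Data.List.Properties using (∷-injectiveˡ; ∷-injectiveʳ; length-map; length-++; length-upTo; length-take; take++drop≡id; ++-assoc)
open import Data.List.Membership.Propositional using (_∈_; _∉_)
open import Data.List.Membership.Propositional.Properties using (∈-map⁺; ∈-map⁻; ∈-∃++; ∈-concat⁺′; ∈-concat⁻′; ∈-++⁺ˡ; ∈-filter⁺; ∈-filter⁻; ∈-cartesianProduct⁺; ∈-cartesianProduct⁻)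
open import Data.List.Membership.Propositional.Properties.WithK using (unique∧set⇒bag)
open import Data.List.Relation.Binary.BagAndSetEquality using (∼bag⇒↭)
open import Data.List.Relation.Binary.Permutation.Propositional using (_↭_; ↭⇒↭ₛ; ↭-refl; ↭-sym; ↭-trans; ↭-reflexive; prep; swap)
open import Data.List.Relation.Binary.Permutation.Propositional.Properties using (↭-length; ∈-resp-↭; ↭-empty-inv; drop-mid; shift; ++⁺ˡ; ++⁺ʳ; ++-comm; filter-↭)
open import Data.List.Relation.Unary.All using (All; []; _∷_; universal) renaming (tabulate to All-tabulate; lookup to All-lookup)
open import Data.List.Relation.Unary.All.Properties using (All¬⇒¬Any; all-filter) renaming (map⁺ to All-map⁺)
open import Data.List.Relation.Unary.Any using (here; there)
open import Data.List.Relation.Unary.Unique.Propositional using (Unique; []; _∷_)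
import Data.List.Relation.Unary.Unique.Propositional.Properties as Unique
open import Data.Nat using (ℕ; suc; _≤_; _<_; _>_; _⊓_; _+_; _*_; _∸_; _<ᵇ_; z≤n; s≤s)
open import Data.Nat.Properties using (suc-injective; +-comm; +-cancelʳ-≡; *-identityˡ; m≤n⇒m⊓n≡m; m+n≤o⇒n≤o; <⇒≤; <-asym; <-cmp; <ᵇ⇒<; <⇒<ᵇ)
open import Data.Product using (_×_; _,_; proj₁; proj₂; ∃; ∃₂)
open import Data.Rational using (_/_)
open import Data.Rational.Properties using (fromℚᵘ-cong)
open import Data.Rational.Unnormalised using (mkℚᵘ; *≡*)
open import Data.Sum using (_⊎_; inj₁; inj₂) renaming (swap to swap⊎)
open import Function using (_∘_; mk⇔)
open import Relation.Binary.Definitions using (Asymmetric; tri<; tri≈; tri>)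
open import Relation.Binary.PropositionalEquality using (setoid; _≡_; _≢_; refl; sym; trans; cong; cong₂; subst; subst₂; module ≡-Reasoning)
open import Relation.Nullary using (¬_; Dec)

private variable
  A B : Set

++-∷-cancel : ∀ {x : A} l₁ k₁ {l₂ k₂} → x ∉ l₁ → x ∉ k₁ →
  l₁ ++ x ∷ l₂ ≡ k₁ ++ x ∷ k₂ → l₁ ≡ k₁ × l₂ ≡ k₂
++-∷-cancel []       []       _   _   refl = refl , refl
++-∷-cancel []       (k ∷ k₁) _   x∉k eq   = ⊥-elim (x∉k (here (∷-injectiveˡ eq)))
++-∷-cancel (l ∷ l₁) []       x∉l _   eq   = ⊥-elim (x∉l (here (sym (∷-injectiveˡ eq))))
++-∷-cancel (l ∷ l₁) (k ∷ k₁) x∉l x∉k eq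
  with refl ← ∷-injectiveˡ eq
  with l₁≡k₁ , l₂≡k₂ ← ++-∷-cancel l₁ k₁ (x∉l ∘ there) (x∉k ∘ there) (∷-injectiveʳ eq)
  = cong (l ∷_) l₁≡k₁ , l₂≡k₂

++-cancel-length : ∀ (xs xs′ : List A) {ys ys′} → length ys ≡ length ys′ →
  xs ++ ys ≡ xs′ ++ ys′ → xs ≡ xs′ × ys ≡ ys′
++-cancel-length {A = A} xs xs′ {ys} {ys′} |ys|≡ eq = go xs xs′ |xs|≡ eq
  where
  open ≡-Reasoning
  |xs|≡ : length xs ≡ length xs′
  |xs|≡ = +-cancelʳ-≡ (length ys) (length xs) (length xs′) (begin
    length xs + length ys   ≡⟨ length-++ xs ⟨
    length (xs ++ ys)       ≡⟨ cong length eq ⟩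
    length (xs′ ++ ys′)     ≡⟨ length-++ xs′ ⟩
    length xs′ + length ys′ ≡⟨ cong (λ l → length xs′ + l) |ys|≡ ⟨
    length xs′ + length ys  ∎)
  go : ∀ (xs xs′ : List A) → length xs ≡ length xs′ → xs ++ ys ≡ xs′ ++ ys′ → xs ≡ xs′ × ys ≡ ys′
  go []       []         _   eq = refl , eq
  go (x ∷ xs) (x′ ∷ xs′) len eq
    with refl ← ∷-injectiveˡ eq
    with xs≡ , ys≡ ← go xs xs′ (suc-injective len) (∷-injectiveʳ eq)
    = cong (x ∷_) xs≡ , ys≡

≤-length-++ʳ : ∀ d (xs : List A) {ys} → length xs + d ≤ length (xs ++ ys) → d ≤ length ys
≤-length-++ʳ d []       le       = le
≤-length-++ʳ d (_ ∷ xs) (s≤s le) = ≤-length-++ʳ d xs le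

∃-++-pair : ∀ (xs : List A) → 2 ≤ length xs → ∃ λ as → ∃₂ λ u v → xs ≡ as ++ u ∷ v ∷ []
∃-++-pair []               ()
∃-++-pair (_ ∷ [])         (s≤s ())
∃-++-pair (u ∷ v ∷ [])     _ = [] , u , v , refl
∃-++-pair (w ∷ u ∷ v ∷ xs) _ with as , p , q , eq ← ∃-++-pair (u ∷ v ∷ xs) (s≤s (s≤s z≤n)) =
  w ∷ as , p , q , cong (w ∷_) eq

split-++ : ∀ (xs ys : List A) → (take (length xs) (xs ++ ys) , drop (length xs) (xs ++ ys)) ≡ (xs , ys)
split-++ []       ys = refl
split-++ (x ∷ xs) ys = cong (λ (xs′ , ys′) → x ∷ xs′ , ys′) (split-++ xs ys)

split-injective : ∀ k {l l′ : List A} → (take k l , drop k l) ≡ (take k l′ , drop k l′) → l ≡ l′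
split-injective k {l} {l′} eq =
  trans (sym (take++drop≡id k l)) (trans (cong (λ (x , y) → x ++ y) eq) (take++drop≡id k l′))

length-cartesianProduct : ∀ (xs : List A) (ys : List B) →
  length (cartesianProduct xs ys) ≡ length xs * length ys
length-cartesianProduct []       ys = refl
length-cartesianProduct (x ∷ xs) ys =
  trans (length-++ (map (x ,_) ys)) (cong₂ _+_ (length-map (x ,_) ys) (length-cartesianProduct xs ys))

filterᵇ-∧ : ∀ (p q : A → Bool) xs → filterᵇ (λ x → p x ∧ q x) xs ≡ filterᵇ p (filterᵇ q xs)
filterᵇ-∧ p q []       = refl
filterᵇ-∧ p q (x ∷ xs) with q x
... | false rewrite ∧-zeroʳ (p x) = filterᵇ-∧ p q xs
... | true rewrite ∧-identityʳ (p x) with p x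
...   | true  = cong (x ∷_) (filterᵇ-∧ p q xs)
...   | false = filterᵇ-∧ p q xs

filterᵇ-map : ∀ (p : B → Bool) (f : A → B) xs → filterᵇ p (map f xs) ≡ map f (filterᵇ (p ∘ f) xs)
filterᵇ-map p f []       = refl
filterᵇ-map p f (x ∷ xs) with p (f x)
... | true  = cong (f x ∷_) (filterᵇ-map p f xs)
... | false = filterᵇ-map p f xs

pair-distinct : ∀ xs {u v : A} {ys} → Unique (xs ++ u ∷ v ∷ ys) → u ≢ v
pair-distinct []       ((u≢v ∷ _) ∷ _) = u≢v
pair-distinct (_ ∷ xs) (_ ∷ u)         = pair-distinct xs u

unique-resp-↭ : ∀ {xs ys : List A} → xs ↭ ys → Unique xs → Unique ys
unique-resp-↭ {A = A} = Unique-resp-↭ ∘ ↭⇒↭ₛ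
  where open import Data.List.Relation.Binary.Permutation.Setoid.Properties (setoid A) using (Unique-resp-↭)

map⁺-injectiveOn : ∀ {P : A → Set} {f : A → B} {xs} → (∀ {x y} → P x → P y → f x ≡ f y → x ≡ y) →
  All P xs → Unique xs → Unique (map f xs)
map⁺-injectiveOn inj []         []         = []
map⁺-injectiveOn inj (px ∷ pxs) (x≢xs ∷ u) =
  All-map⁺ (All-tabulate λ y∈ fx≡fy → All-lookup x≢xs y∈ (inj px (All-lookup pxs y∈) fx≡fy))
  ∷ map⁺-injectiveOn inj pxs u

unique∧set⇒↭ : ∀ {xs ys : List A} → Unique xs → Unique ys →
  (∀ {z} → z ∈ xs → z ∈ ys) → (∀ {z} → z ∈ ys → z ∈ xs) → xs ↭ ys
unique∧set⇒↭ u v to from = ∼bag⇒↭ (unique∧set⇒bag u v (mk⇔ to from))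

-- Enumerating permutations

∈-insertEverywhere⁺ : ∀ x l₁ l₂ → l₁ ++ x ∷ l₂ ∈ insertEverywhere x (l₁ ++ l₂)
∈-insertEverywhere⁺ x []       []       = here refl
∈-insertEverywhere⁺ x []       (y ∷ l₂) = here refl
∈-insertEverywhere⁺ x (y ∷ l₁) l₂       = there (∈-map⁺ (y ∷_) (∈-insertEverywhere⁺ x l₁ l₂))

∈-insertEverywhere⁻ : ∀ x p {l} → l ∈ insertEverywhere x p →
  ∃₂ λ l₁ l₂ → p ≡ l₁ ++ l₂ × l ≡ l₁ ++ x ∷ l₂
∈-insertEverywhere⁻ x []      (here refl) = [] , [] , refl , refl
∈-insertEverywhere⁻ x (y ∷ p) (here refl) = [] , y ∷ p , refl , refl
∈-insertEverywhere⁻ x (y ∷ p) (there l∈)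
  with _ , l′∈ , refl ← ∈-map⁻ (y ∷_) l∈
  with l₁ , l₂ , refl , refl ← ∈-insertEverywhere⁻ x p l′∈
  = y ∷ l₁ , l₂ , refl , refl

insertEverywhere-unique : ∀ x p → x ∉ p → Unique (insertEverywhere x p)
insertEverywhere-unique x []      _  = [] ∷ []
insertEverywhere-unique x (y ∷ p) x∉ =
  All-map⁺ (universal (λ _ eq → x∉ (here (∷-injectiveˡ eq))) _)
  ∷ Unique.map⁺ ∷-injectiveʳ (insertEverywhere-unique x p (x∉ ∘ there))

insertEverywhere-disjoint : ∀ x {p q l} → x ∉ p → x ∉ q →
  l ∈ insertEverywhere x p → l ∈ insertEverywhere x q → p ≡ q
insertEverywhere-disjoint x {p} {q} x∉p x∉q l∈p l∈q
  with l₁ , l₂ , refl , refl ← ∈-insertEverywhere⁻ x p l∈p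
  with k₁ , k₂ , refl , eq ← ∈-insertEverywhere⁻ x q l∈q
  with refl , refl ← ++-∷-cancel l₁ k₁ (x∉p ∘ ∈-++⁺ˡ) (x∉q ∘ ∈-++⁺ˡ) eq
  = refl

concatMap-insertEverywhere-unique : ∀ x {ps} → All (x ∉_) ps → Unique ps →
  Unique (concatMap (insertEverywhere x) ps)
concatMap-insertEverywhere-unique x         []           []         = []
concatMap-insertEverywhere-unique x {p ∷ ps} (x∉p ∷ x∉ps) (p≢ps ∷ u) =
  Unique.++⁺ (insertEverywhere-unique x p x∉p) (concatMap-insertEverywhere-unique x x∉ps u) disjoint
  where
  disjoint : ∀ {l} → ¬ (l ∈ insertEverywhere x p × l ∈ concatMap (insertEverywhere x) ps)
  disjoint (l∈p , l∈ps)
    with q , l∈q , q∈ ← ∈-concat⁻′ (map (insertEverywhere x) ps) l∈ps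
    with q , q∈ps , refl ← ∈-map⁻ (insertEverywhere x) q∈
    = All-lookup p≢ps q∈ps (insertEverywhere-disjoint x x∉p (All-lookup x∉ps q∈ps) l∈p l∈q)

∈-perms⁺ : ∀ xs {l} → l ↭ xs → l ∈ perms xs
∈-perms⁺ []       l↭[] with refl ← ↭-empty-inv l↭[] = here refl
∈-perms⁺ (x ∷ xs) l↭ with l₁ , l₂ , refl ← ∈-∃++ (∈-resp-↭ (↭-sym l↭) (here refl)) =
  ∈-concat⁺′ (∈-insertEverywhere⁺ x l₁ l₂) (∈-map⁺ (insertEverywhere x) (∈-perms⁺ xs (drop-mid l₁ [] l↭)))

∈-perms⁻ : ∀ xs {l} → l ∈ perms xs → l ↭ xs
∈-perms⁻ []       (here refl) = ↭-refl
∈-perms⁻ (x ∷ xs) l∈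
  with p , l∈p , p∈ ← ∈-concat⁻′ (map (insertEverywhere x) (perms xs)) l∈
  with q , q∈ , refl ← ∈-map⁻ (insertEverywhere x) p∈
  with l₁ , l₂ , refl , refl ← ∈-insertEverywhere⁻ x q l∈p
  = ↭-trans (shift x l₁ l₂) (prep x (∈-perms⁻ xs q∈))

perms-unique : ∀ {xs} → Unique xs → Unique (perms xs)
perms-unique          []         = [] ∷ []
perms-unique {x ∷ xs} (x∉xs ∷ u) =
  concatMap-insertEverywhere-unique x
    (All-tabulate λ p∈ x∈p → All¬⇒¬Any x∉xs (∈-resp-↭ (∈-perms⁻ xs p∈) x∈p))
    (perms-unique u)

length-perms-nonzero : ∀ (xs : List ℕ) → ∃ λ j → length (perms xs) ≡ suc j
length-perms-nonzero xs with perms xs | ∈-perms⁺ xs ↭-refl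
... | _ ∷ ps | _ = length ps , refl

count≡length-↭ : ∀ (F : A → Bool) (f : A → B) xs {ys} → map f (filterᵇ F xs) ↭ ys →
  count F xs ≡ length ys
count≡length-↭ F f xs f[xs]↭ = trans (sym (length-map f (filterᵇ F xs))) (↭-length f[xs]↭)

PrCond≡Pr-↭ : ∀ (E : B → Bool) (F : A → Bool) (f : A → B) xs {ys} → map f (filterᵇ F xs) ↭ ys →
  PrCond xs (λ x → E (f x)) F ≡ Pr ys E
PrCond≡Pr-↭ E F f xs {ys} f[xs]↭ = cong₂ frac count-∧ (count≡length-↭ F f xs f[xs]↭)
  where
  open ≡-Reasoning
  count-∧ : count (λ x → E (f x) ∧ F x) xs ≡ count E ys
  count-∧ = begin
    length (filterᵇ (λ x → E (f x) ∧ F x) xs)       ≡⟨ cong length (filterᵇ-∧ (E ∘ f) F xs) ⟩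
    length (filterᵇ (E ∘ f) (filterᵇ F xs))         ≡⟨ length-map f (filterᵇ (E ∘ f) (filterᵇ F xs)) ⟨
    length (map f (filterᵇ (E ∘ f) (filterᵇ F xs))) ≡⟨ cong length (filterᵇ-map E f (filterᵇ F xs)) ⟨
    length (filterᵇ E (map f (filterᵇ F xs)))       ≡⟨ ↭-length (filter-↭ (T? ∘ E) f[xs]↭) ⟩
    length (filterᵇ E ys)                           ∎

frac-half : ∀ k → frac (suc k) (suc k * 2) ≡ (+ 1) / 2
frac-half k = fromℚᵘ-cong {mkℚᵘ (+ suc k) (suc (k * 2))} {mkℚᵘ (+ 1) 1}
  (*≡* (cong +_ (sym (*-identityˡ (suc k * 2)))))

deck : State → List ℕ
deck (x , y) = x ++ y

cards-unique : ∀ n → Unique (cards n)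
cards-unique n = Unique.map⁺ suc-injective (Unique.upTo⁺ n)

↭-cards⇒unique : ∀ {n xs} → xs ↭ cards n → Unique xs
↭-cards⇒unique {n} xs↭ = unique-resp-↭ (↭-sym xs↭) (cards-unique n)

length-↭-cards : ∀ {n xs} → xs ↭ cards n → length xs ≡ n
length-↭-cards {n} xs↭ = trans (↭-length xs↭) (trans (length-map suc (upTo n)) (length-upTo n))

∈-states⁺ : ∀ {n k} s → deck s ↭ cards n → length (proj₁ s) ≡ k → s ∈ states n k
∈-states⁺ {n} (x , y) x++y↭ refl =
  subst (_∈ states n (length x)) (split-++ x y) (∈-map⁺ _ (∈-perms⁺ (cards n) x++y↭))

∈-states⁻ : ∀ {n k s} → k ≤ n → s ∈ states n k → deck s ↭ cards n × length (proj₁ s) ≡ k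
∈-states⁻ {n} {k} k≤n s∈ with l , l∈ , refl ← ∈-map⁻ _ s∈ =
  subst (_↭ cards n) (sym (take++drop≡id k l)) l↭ ,
  trans (length-take k l) (trans (cong (k ⊓_) (length-↭-cards l↭)) (m≤n⇒m⊓n≡m k≤n))
  where
  l↭ : l ↭ cards n
  l↭ = ∈-perms⁻ (cards n) l∈

states-unique : ∀ n k → Unique (states n k)
states-unique n k = Unique.map⁺ (split-injective k) (perms-unique (cards-unique n))

length-states : ∀ n k → length (states n k) ≡ length (perms (cards n))
length-states n k = length-map _ (perms (cards n))

coins : List Bool
coins = true ∷ false ∷ []

outcomes≡cartesianProduct : ∀ n m → outcomes n m ≡ cartesianProduct (states n m) coins
outcomes≡cartesianProduct n m = go (states n m)
  where
  go : ∀ ss → concatMap (λ s → map (s ,_) coins) ss ≡ cartesianProduct ss coins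
  go []       = refl
  go (s ∷ ss) = cong (map (s ,_) coins ++_) (go ss)

∈-outcomes⁺ : ∀ {n m s} c → s ∈ states n m → (s , c) ∈ outcomes n m
∈-outcomes⁺ {n} {m} {s} c s∈ =
  subst ((s , c) ∈_) (sym (outcomes≡cartesianProduct n m)) (∈-cartesianProduct⁺ s∈ (∈-coins c))
  where
  ∈-coins : ∀ c → c ∈ coins
  ∈-coins true  = here refl
  ∈-coins false = there (here refl)

∈-outcomes⁻ : ∀ {n m o} → o ∈ outcomes n m → startState o ∈ states n m
∈-outcomes⁻ {n} {m} {o} o∈ =
  proj₁ (∈-cartesianProduct⁻ (states n m) coins (subst (o ∈_) (outcomes≡cartesianProduct n m) o∈))

outcomes-unique : ∀ n m → Unique (outcomes n m)
outcomes-unique n m = subst Unique (sym (outcomes≡cartesianProduct n m))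
  (Unique.cartesianProduct⁺ (states-unique n m) (((λ ()) ∷ []) ∷ [] ∷ []))

length-outcomes : ∀ n m → length (outcomes n m) ≡ length (states n m) * 2
length-outcomes n m =
  trans (cong length (outcomes≡cartesianProduct n m)) (length-cartesianProduct (states n m) coins)

-- One round

length-putback : ∀ c a b → length (putback c a b) ≡ 2
length-putback true  a b = refl
length-putback false a b = refl

length-++-putback : ∀ as c a b → length (as ++ putback c a b) ≡ suc (suc (length as))
length-++-putback as c a b =
  trans (length-++ as) (trans (cong (λ l → length as + l) (length-putback c a b)) (+-comm (length as) 2))

putback-↭ : ∀ c a b → putback c a b ↭ a ∷ b ∷ []
putback-↭ true  a b = ↭-refl
putback-↭ false a b = swap b a ↭-refl

putback-between-↭ : ∀ c a b as bs → as ++ putback c a b ++ bs ↭ (a ∷ as) ++ b ∷ bs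
putback-between-↭ c a b as bs = ↭-trans (++⁺ˡ as (++⁺ʳ bs (putback-↭ c a b))) (shift a as (b ∷ bs))

module _ {_beats_ : ℕ → ℕ → Set} where

  putback-injective : Asymmetric _beats_ → ∀ {c c′ a a′ b b′} → a beats b → a′ beats b′ →
    putback c a b ≡ putback c′ a′ b′ → c ≡ c′ × a ≡ a′ × b ≡ b′
  putback-injective asym {true}  {true}  _ _  refl = refl , refl , refl
  putback-injective asym {false} {false} _ _  refl = refl , refl , refl
  putback-injective asym {true}  {false} r r′ refl = ⊥-elim (asym r′ r)
  putback-injective asym {false} {true}  r r′ refl = ⊥-elim (asym r′ r)

  putback-surjective : (∀ {u v} → u ≢ v → u beats v ⊎ v beats u) → ∀ {u v} → u ≢ v →
    ∃₂ λ a b → ∃ λ c → a beats b × putback c a b ≡ u ∷ v ∷ []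
  putback-surjective compare {u} {v} u≢v with compare u≢v
  ... | inj₁ u-beats-v = u , v , true  , u-beats-v , refl
  ... | inj₂ v-beats-u = v , u , false , v-beats-u , refl

≢⇒<⊎> : ∀ {u v} → u ≢ v → u < v ⊎ u > v
≢⇒<⊎> {u} {v} u≢v with <-cmp u v
... | tri< u<v _ _ = inj₁ u<v
... | tri≈ _ u≡v _ = ⊥-elim (u≢v u≡v)
... | tri> _ _ u>v = inj₂ u>v

playRound-↭ : ∀ s c → deck (playRound s c) ↭ deck s
playRound-↭ ([]     , _)      c = ↭-refl
playRound-↭ (_ ∷ _  , [])     c = ↭-refl
playRound-↭ (a ∷ as , b ∷ bs) c with b <ᵇ a
... | true  = ↭-trans (↭-reflexive (++-assoc as (putback c a b) bs)) (putback-between-↭ c a b as bs)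
... | false = ↭-trans (++⁺ˡ as (++-comm bs (putback c a b))) (putback-between-↭ c a b as bs)

playRound-aliceWins : ∀ {a b} as bs c → b < a →
  playRound (a ∷ as , b ∷ bs) c ≡ (as ++ putback c a b , bs)
playRound-aliceWins {a} {b} as bs c b<a with b <ᵇ a | <⇒<ᵇ b<a
... | true | _ = refl

playRound-bobWins : ∀ {a b} as bs c → a < b →
  playRound (a ∷ as , b ∷ bs) c ≡ (as , bs ++ putback c a b)
playRound-bobWins {a} {b} as bs c a<b with b <ᵇ a | <ᵇ⇒< b a
... | false | _   = refl
... | true  | b<a = ⊥-elim (<-asym a<b (b<a _))

-- The results of the winning outcomes

winningResults : (State → Bool) → ℕ → ℕ → List State
winningResults wins n m = map result (filterᵇ (wins ∘ startState) (outcomes n m))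

winningResults-↭ : ∀ wins n m {targets} → Unique targets →
  (∀ {o o′} → T (wins (startState o)) → T (wins (startState o′)) → result o ≡ result o′ → o ≡ o′) →
  (∀ {o} → o ∈ outcomes n m → T (wins (startState o)) → result o ∈ targets) →
  (∀ {z} → z ∈ targets → ∃ λ o → o ∈ outcomes n m × T (wins (startState o)) × result o ≡ z) →
  winningResults wins n m ↭ targets
winningResults-↭ wins n m {targets} targets-unique injective into onto =
  unique∧set⇒↭
    (map⁺-injectiveOn injective (all-filter wins? (outcomes n m)) (Unique.filter⁺ wins? (outcomes-unique n m)))
    targets-unique to from
  where
  wins? : ∀ o → Dec (T (wins (startState o)))
  wins? = T? ∘ wins ∘ startState
  to : ∀ {z} → z ∈ winningResults wins n m → z ∈ targets
  to z∈ with o , o∈ , refl ← ∈-map⁻ result z∈ with o∈outcomes , w ← ∈-filter⁻ wins? o∈ = into o∈outcomes w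
  from : ∀ {z} → z ∈ targets → z ∈ winningResults wins n m
  from z∈ with o , o∈ , w , refl ← onto z∈ = ∈-map⁺ result (∈-filter⁺ wins? o∈ w)

aliceWins-result-injective : ∀ {o o′} → T (aliceWins (startState o)) → T (aliceWins (startState o′)) →
  result o ≡ result o′ → o ≡ o′
aliceWins-result-injective {([] , _) , _} ()
aliceWins-result-injective {(_ ∷ _ , []) , _} ()
aliceWins-result-injective {(_ ∷ _ , _ ∷ _) , _} {([] , _) , _} _ ()
aliceWins-result-injective {(_ ∷ _ , _ ∷ _) , _} {(_ ∷ _ , []) , _} _ ()
aliceWins-result-injective {(a ∷ as , b ∷ bs) , c} {(a′ ∷ as′ , b′ ∷ bs′) , c′} w w′ eq
  with b<a ← <ᵇ⇒< b a w | b′<a′ ← <ᵇ⇒< b′ a′ w′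
  with eq′ ← trans (sym (playRound-aliceWins as bs c b<a)) (trans eq (playRound-aliceWins as′ bs′ c′ b′<a′))
  with refl , pb≡ ← ++-cancel-length as as′ (trans (length-putback c a b) (sym (length-putback c′ a′ b′)))
                                      (cong proj₁ eq′)
  with refl , refl , refl ← putback-injective {_>_} <-asym b<a b′<a′ pb≡
  with refl ← cong proj₂ eq′
  = refl

bobWins-result-injective : ∀ {o o′} → T (bobWins (startState o)) → T (bobWins (startState o′)) →
  result o ≡ result o′ → o ≡ o′
bobWins-result-injective {([] , _) , _} ()
bobWins-result-injective {(_ ∷ _ , []) , _} ()
bobWins-result-injective {(_ ∷ _ , _ ∷ _) , _} {([] , _) , _} _ ()
bobWins-result-injective {(_ ∷ _ , _ ∷ _) , _} {(_ ∷ _ , []) , _} _ ()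
bobWins-result-injective {(a ∷ as , b ∷ bs) , c} {(a′ ∷ as′ , b′ ∷ bs′) , c′} w w′ eq
  with a<b ← <ᵇ⇒< a b w | a′<b′ ← <ᵇ⇒< a′ b′ w′
  with eq′ ← trans (sym (playRound-bobWins as bs c a<b)) (trans eq (playRound-bobWins as′ bs′ c′ a′<b′))
  with refl , pb≡ ← ++-cancel-length bs bs′ (trans (length-putback c a b) (sym (length-putback c′ a′ b′)))
                                      (cong proj₂ eq′)
  with refl , refl , refl ← putback-injective {_<_} <-asym a<b a′<b′ pb≡
  with refl ← cong proj₁ eq′
  = refl

aliceWins-result-∈ : ∀ {n m o} → m ≤ n → o ∈ outcomes n m → T (aliceWins (startState o)) →
  result o ∈ states n (suc m)
aliceWins-result-∈ {o = ([] , _) , _} _ _ ()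
aliceWins-result-∈ {o = (_ ∷ _ , []) , _} _ _ ()
aliceWins-result-∈ {n} {m} {(a ∷ as , b ∷ bs) , c} m≤n o∈ w
  with deck↭ , refl ← ∈-states⁻ m≤n (∈-outcomes⁻ {n} {m} o∈)
  = ∈-states⁺ _ (↭-trans (playRound-↭ (a ∷ as , b ∷ bs) c) deck↭)
      (trans (cong (length ∘ proj₁) (playRound-aliceWins as bs c (<ᵇ⇒< b a w))) (length-++-putback as c a b))

bobWins-result-∈ : ∀ {n m o} → m ≤ n → o ∈ outcomes n m → T (bobWins (startState o)) →
  result o ∈ states n (m ∸ 1)
bobWins-result-∈ {o = ([] , _) , _} _ _ ()
bobWins-result-∈ {o = (_ ∷ _ , []) , _} _ _ ()
bobWins-result-∈ {n} {m} {(a ∷ as , b ∷ bs) , c} m≤n o∈ w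
  with deck↭ , refl ← ∈-states⁻ m≤n (∈-outcomes⁻ {n} {m} o∈)
  = ∈-states⁺ _ (↭-trans (playRound-↭ (a ∷ as , b ∷ bs) c) deck↭)
      (cong (length ∘ proj₁) (playRound-bobWins as bs c (<ᵇ⇒< a b w)))

aliceWins-result-onto : ∀ {n k z} → suc k < n → z ∈ states n (suc (suc k)) →
  ∃ λ o → o ∈ outcomes n (suc k) × T (aliceWins (startState o)) × result o ≡ z
aliceWins-result-onto {n} {k} {x , y} k+1<n z∈
  with deck↭ , |x|≡ ← ∈-states⁻ k+1<n z∈
  with as , u , v , refl ← ∃-++-pair x (subst (2 ≤_) (sym |x|≡) (s≤s (s≤s z≤n)))
  with a , b , c , b<a , pb≡ ← putback-surjective {_>_} (swap⊎ ∘ ≢⇒<⊎>)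
         (pair-distinct as (subst Unique (++-assoc as (u ∷ v ∷ []) y) (↭-cards⇒unique deck↭)))
  = ((a ∷ as , b ∷ y) , c) , ∈-outcomes⁺ {n} c (∈-states⁺ _ start↭ |start|≡) , <⇒<ᵇ b<a , res
  where
  res : result ((a ∷ as , b ∷ y) , c) ≡ (as ++ u ∷ v ∷ [] , y)
  res = trans (playRound-aliceWins as y c b<a) (cong (λ p → as ++ p , y) pb≡)
  start↭ : deck (a ∷ as , b ∷ y) ↭ cards n
  start↭ = ↭-trans (↭-sym (playRound-↭ (a ∷ as , b ∷ y) c)) (subst (λ s → deck s ↭ cards n) (sym res) deck↭)
  |start|≡ : suc (length as) ≡ suc k
  |start|≡ = suc-injective (trans (sym (length-++-putback as true u v)) |x|≡)

bobWins-result-onto : ∀ {n k z} → suc k < n → z ∈ states n k →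
  ∃ λ o → o ∈ outcomes n (suc k) × T (bobWins (startState o)) × result o ≡ z
bobWins-result-onto {n} {k} {x , y} k+1<n z∈
  with deck↭ , refl ← ∈-states⁻ (m+n≤o⇒n≤o 2 k+1<n) z∈
  with bs , u , v , refl ← ∃-++-pair y
         (≤-length-++ʳ 2 x (subst₂ _≤_ (+-comm 2 (length x)) (sym (length-↭-cards deck↭)) k+1<n))
  with a , b , c , a<b , pb≡ ← putback-surjective {_<_} ≢⇒<⊎>
         (pair-distinct (x ++ bs) (subst Unique (sym (++-assoc x bs (u ∷ v ∷ []))) (↭-cards⇒unique deck↭)))
  = ((a ∷ x , b ∷ bs) , c) , ∈-outcomes⁺ {n} c (∈-states⁺ _ start↭ refl) , <⇒<ᵇ a<b , res
  where
  res : result ((a ∷ x , b ∷ bs) , c) ≡ (x , bs ++ u ∷ v ∷ [])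
  res = trans (playRound-bobWins x bs c a<b) (cong (λ p → x , bs ++ p) pb≡)
  start↭ : deck (a ∷ x , b ∷ bs) ↭ cards n
  start↭ = ↭-trans (↭-sym (playRound-↭ (a ∷ x , b ∷ bs) c)) (subst (λ s → deck s ↭ cards n) (sym res) deck↭)

aliceWinningResults-↭ : ∀ {n k} → suc k < n → winningResults aliceWins n (suc k) ↭ states n (suc (suc k))
aliceWinningResults-↭ {n} {k} k+1<n =
  winningResults-↭ aliceWins n (suc k) (states-unique n (suc (suc k))) aliceWins-result-injective
    (aliceWins-result-∈ (<⇒≤ k+1<n)) (aliceWins-result-onto k+1<n)

bobWinningResults-↭ : ∀ {n k} → suc k < n → winningResults bobWins n (suc k) ↭ states n k
bobWinningResults-↭ {n} {k} k+1<n =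
  winningResults-↭ bobWins n (suc k) (states-unique n k) bobWins-result-injective
    (bobWins-result-∈ (<⇒≤ k+1<n)) (bobWins-result-onto k+1<n)

lemma5p1 : (n m : ℕ) → 0 < m → m < n →
    (Pr (outcomes n m) (λ o → aliceWins (startState o)) ≡ (+ 1) / 2)
    × (∀ (s : State) →
        PrCond (outcomes n m) (λ o → result o ≟S s) (λ o → aliceWins (startState o))
          ≡ uniform (states n (suc m)) s)
    × (∀ (s : State) →
        PrCond (outcomes n m) (λ o → result o ≟S s) (λ o → bobWins (startState o))
          ≡ uniform (states n (m ∸ 1)) s)
lemma5p1 n (suc k) (s≤s z≤n) k+1<n =
  aliceWins-half ,
  (λ s → PrCond≡Pr-↭ (_≟S s) (aliceWins ∘ startState) result (outcomes n (suc k)) alice↭) ,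
  (λ s → PrCond≡Pr-↭ (_≟S s) (bobWins ∘ startState) result (outcomes n (suc k)) bob↭)
  where
  alice↭ : winningResults aliceWins n (suc k) ↭ states n (suc (suc k))
  alice↭ = aliceWinningResults-↭ k+1<n
  bob↭ : winningResults bobWins n (suc k) ↭ states n k
  bob↭ = bobWinningResults-↭ k+1<n
  open ≡-Reasoning
  aliceWins-half : Pr (outcomes n (suc k)) (aliceWins ∘ startState) ≡ (+ 1) / 2
  aliceWins-half with j , |perms|≡ ← length-perms-nonzero (cards n) = begin
    frac (count (aliceWins ∘ startState) (outcomes n (suc k))) (length (outcomes n (suc k)))
      ≡⟨ cong₂ frac (count≡length-↭ (aliceWins ∘ startState) result (outcomes n (suc k)) alice↭)
                    (length-outcomes n (suc k)) ⟩
    frac (length (states n (suc (suc k)))) (length (states n (suc k)) * 2)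
      ≡⟨ cong₂ (λ a b → frac a (b * 2)) (|states|≡ (suc (suc k))) (|states|≡ (suc k)) ⟩
    frac (suc j) (suc j * 2)
      ≡⟨ frac-half j ⟩
    (+ 1) / 2 ∎
    where
    |states|≡ : ∀ k → length (states n k) ≡ suc j
    |states|≡ k = trans (length-states n k) |perms|≡
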